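{- Let $n\in\mathbb{N}$. Then \[ \mathsf{g}_{\pm}(C_n)=\begin{cases} n+1 & \text{if } n\equiv 2 \pmod 4,\\ n & \text{otherwise}.\end{cases} \]
   Context: For a finite abelian group $G$ (written additively), $\exp(G)$ denotes its exponent and $C_m$ a cyclic group of order $m$. The plus-minus weighted Harborth constant $\mathsf{g}_{\pm}(G)$ is the smallest $\ell\in\mathbb{N}$ such that for every subset $S\subseteq G$ with $|S|\ge\ell$ there exist $\exp(G)$ distinct elements $g_1,\dots,g_{\exp(G)}\in S$ and signs $\varepsilon_1,\dots,\varepsilon_{\exp(G)}\in\{+1,-1\}$ with $\sum_i \varepsilon_i g_i=0$. (If no subset of $G$ has cardinality $\ell$, the condition is vacuously satisfied.) -}

module Defs where

open import Data.Nat using (ℕ; zero; suc; _≤_; _<_)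
open import Data.Fin using (Fin; toℕ)
import Data.Fin as F
open import Data.Fin.Subset using (Subset; _∈_; ∣_∣)
open import Data.Integer using (ℤ; +_; -_; _+_)
open import Data.Integer.Divisibility using (_∣_)
open import Data.Sign using (Sign)
open import Data.Product using (Σ; _×_)
open import Relation.Binary.PropositionalEquality using (_≡_)
open import Relation.Nullary using (¬_)
open import Function.Definitions using (Injective)

-- The cyclic group C_n is modelled as ℤ/nℤ: its elements are the residues
-- 0,…,n-1, i.e. Fin n, and a signed sum of elements is zero in C_n iff the
-- corresponding integer sum is divisible by n.  exp(C_n) = n.

sumFin : ∀ {k} → (Fin k → ℤ) → ℤ
sumFin {zero}  f = + 0
sumFin {suc k} f = f F.zero + sumFin (λ i → f (F.suc i))

applySign : Sign → ℤ → ℤ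
applySign Sign.+ z = z
applySign Sign.- z = - z

HasPMZeroSum : (n : ℕ) → Subset n → Set
HasPMZeroSum n S =
  Σ (Fin n → Fin n) λ g →
    Injective _≡_ _≡_ g ×
    (∀ i → g i ∈ S) ×
    Σ (Fin n → Sign) λ ε →
      (+ n) ∣ sumFin (λ i → applySign (ε i) (+ toℕ (g i)))

PMProperty : (n ℓ : ℕ) → Set
PMProperty n ℓ = ∀ (S : Subset n) → ℓ ≤ ∣ S ∣ → HasPMZeroSum n S

IsPMHarborth : (n m : ℕ) → Set
IsPMHarborth n m = PMProperty n m × (∀ ℓ → ℓ < m → ¬ PMProperty n ℓ)

module Submission where

open import Defs
open import Data.Nat using (ℕ; suc; _≤_; _%_)
open import Data.Product using (_×_)
open import Relation.Binary.PropositionalEquality using (_≡_; _≢_)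

open import Data.Nat as ℕ using (zero; _<_; _*_; s≤s; s≤s⁻¹)
import Data.Nat.Properties as ℕ
import Data.Nat.Divisibility as ℕ
open import Data.Nat.DivMod using ([m+kn]%n≡m%n)
open import Data.Nat.Tactic.RingSolver as ℕ-Solver using ()
open import Data.Fin as Fin using (Fin; toℕ; punchOut)
import Data.Fin.Properties as Fin
open import Data.Fin.Permutation using (Permutation; permutation)
open import Data.Fin.Subset using (Subset; ⊤; outside; _∈_)
import Data.Fin.Subset.Properties as Subset
open import Data.Integer as ℤ using (ℤ; +_; -_)
import Data.Integer.Properties as ℤ
open import Data.Integer.Divisibility using (_∣_)
import Data.Integer.Divisibility.Signed as ℤ
open import Data.Integer.Tactic.RingSolver using (solve-∀)
open import Data.Sign using (Sign)
open import Data.Product using (∃; _,_; proj₁; proj₂)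
open import Data.Vec using (_∷_)
open import Data.Vec.Functional using (init)
open import Function.Definitions using (Injective)
open import Relation.Nullary using (¬_; yes; no; contradiction)
open import Relation.Binary.PropositionalEquality
  using (refl; sym; trans; cong; cong₂; subst; module ≡-Reasoning)
import Algebra.Properties.CommutativeMonoid.Sum as CommutativeMonoidSum

-- Only S = C_n itself has n distinct elements, so g_±(C_n) is n or n + 1
-- according as the whole group admits a ±-zero-sum in which every element
-- occurs once.  Signs do not change parities, so such a sum has the parity of
-- 0 + 1 + ⋯ + (n - 1) = n(n - 1)/2; for n ≡ 2 (mod 4) this is odd while n is
-- even, so no sign choice works.  Otherwise one exists: all signs + when n is
-- odd, and the pattern + - - + on consecutive blocks of four when 4 ∣ n.

module ∑ = CommutativeMonoidSum ℤ.+-0-commutativeMonoid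

sumTo : (ℕ → ℤ) → ℕ → ℤ
sumTo h zero    = + 0
sumTo h (suc n) = sumTo h n ℤ.+ h n

sumFin≡∑ : ∀ {k} (f : Fin k → ℤ) → sumFin f ≡ ∑.sum f
sumFin≡∑ {zero}  f = refl
sumFin≡∑ {suc k} f = cong (ℤ._+_ (f Fin.zero)) (sumFin≡∑ (λ i → f (Fin.suc i)))

sumFin-toℕ : ∀ n (h : ℕ → ℤ) → sumFin {n} (λ i → h (toℕ i)) ≡ sumTo h n
sumFin-toℕ zero    h = refl
sumFin-toℕ (suc n) h = begin
  sumFin t                              ≡⟨ sumFin≡∑ t ⟩
  ∑.sum t                               ≡⟨ ∑.sum-init-last t ⟩
  ∑.sum (init t) ℤ.+ t (Fin.fromℕ n)    ≡⟨ cong₂ ℤ._+_ init≡ (cong h (Fin.toℕ-fromℕ n)) ⟩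
  sumTo h n ℤ.+ h n                     ∎
  where
  open ≡-Reasoning
  t : Fin (suc n) → ℤ
  t i = h (toℕ i)
  s : Fin n → ℤ
  s i = h (toℕ i)
  init≡ : ∑.sum (init t) ≡ sumTo h n
  init≡ = begin
    ∑.sum (init t) ≡⟨ ∑.sum-cong-≗ {n} {init t} {s} (λ i → cong h (Fin.toℕ-inject₁ i)) ⟩
    ∑.sum s        ≡⟨ sumFin≡∑ s ⟨
    sumFin s       ≡⟨ sumFin-toℕ n h ⟩
    sumTo h n      ∎

injective⇒surjective : ∀ {n} {g : Fin n → Fin n} → Injective _≡_ _≡_ g →
                       ∀ y → ∃ λ x → g x ≡ y
injective⇒surjective {suc n} {g} g-inj y with Fin.any? (λ x → g x Fin.≟ y)
... | yes hit = hit
... | no miss = contradiction (Fin.injective⇒≤ h-inj) ℕ.1+n≰n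
  where
  y≢g : ∀ x → y ≢ g x
  y≢g x y≡gx = miss (x , sym y≡gx)
  h : Fin (suc n) → Fin n
  h x = punchOut (y≢g x)
  h-inj : Injective _≡_ _≡_ h
  h-inj eq = g-inj (Fin.punchOut-injective (y≢g _) (y≢g _) eq)

sumFin-permute : ∀ {n} (f : Fin n → ℤ) {g : Fin n → Fin n} → Injective _≡_ _≡_ g →
                 sumFin (λ i → f (g i)) ≡ sumFin f
sumFin-permute {n} f {g} g-inj = begin
  sumFin (λ i → f (g i)) ≡⟨ sumFin≡∑ (λ i → f (g i)) ⟩
  ∑.sum (λ i → f (g i))  ≡⟨ ∑.sum-permute f π ⟨
  ∑.sum f                ≡⟨ sumFin≡∑ f ⟨
  sumFin f               ∎
  where
  open ≡-Reasoning
  g⁻¹ : Fin n → Fin n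
  g⁻¹ y = proj₁ (injective⇒surjective g-inj y)
  π : Permutation n n
  π = permutation g g⁻¹ (λ y → proj₂ (injective⇒surjective g-inj y))
                        (λ x → g-inj (proj₂ (injective⇒surjective g-inj (g x))))

applySign-parity : ∀ s z → + 2 ℤ.∣ applySign s z ℤ.- z
applySign-parity Sign.+ z = ℤ.divides (+ 0) (ℤ.+-inverseʳ z)
applySign-parity Sign.- z = ℤ.divides (- z) (-z-z≡-z*2 z)
  where
  -z-z≡-z*2 : ∀ z → - z ℤ.- z ≡ - z ℤ.* + 2
  -z-z≡-z*2 = solve-∀

signedSum-parity : ∀ {k} (ε : Fin k → Sign) (f : Fin k → ℤ) →
                   + 2 ℤ.∣ sumFin (λ i → applySign (ε i) (f i)) ℤ.- sumFin f
signedSum-parity {zero}  ε f = ℤ.divides (+ 0) refl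
signedSum-parity {suc k} ε f =
  subst (+ 2 ℤ.∣_) (interchange (applySign (ε Fin.zero) (f Fin.zero)) (f Fin.zero) _ _)
    (ℤ.∣m∣n⇒∣m+n (applySign-parity (ε Fin.zero) (f Fin.zero))
                 (signedSum-parity (λ i → ε (Fin.suc i)) (λ i → f (Fin.suc i))))
  where
  interchange : ∀ a b c d → (a ℤ.- b) ℤ.+ (c ℤ.- d) ≡ (a ℤ.+ c) ℤ.- (b ℤ.+ d)
  interchange = solve-∀

triangle : ℕ → ℕ
triangle zero    = 0
triangle (suc n) = triangle n ℕ.+ n

sumTo-+≡triangle : ∀ n → sumTo +_ n ≡ + triangle n
sumTo-+≡triangle zero    = refl
sumTo-+≡triangle (suc n) = trans (cong (ℤ._+ + n) (sumTo-+≡triangle n)) (sym (ℤ.pos-+ (triangle n) n))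

triangle-gauss : ∀ n → triangle (suc n) * 2 ≡ suc n * n
triangle-gauss zero    = refl
triangle-gauss (suc n) = begin
  (triangle (suc n) ℕ.+ suc n) * 2   ≡⟨ ℕ.*-distribʳ-+ 2 (triangle (suc n)) (suc n) ⟩
  triangle (suc n) * 2 ℕ.+ suc n * 2 ≡⟨ cong (ℕ._+ suc n * 2) (triangle-gauss n) ⟩
  suc n * n ℕ.+ suc n * 2            ≡⟨ distrib n ⟩
  suc (suc n) * suc n                ∎
  where
  open ≡-Reasoning
  distrib : ∀ n → suc n * n ℕ.+ suc n * 2 ≡ suc (suc n) * suc n
  distrib = ℕ-Solver.solve-∀

triangle-odd : ∀ j → triangle (suc (j * 2)) ≡ j * suc (j * 2)
triangle-odd j = ℕ.*-cancelʳ-≡ _ _ 2 (trans (triangle-gauss (j * 2)) (regroup j))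
  where
  regroup : ∀ j → suc (j * 2) * (j * 2) ≡ j * suc (j * 2) * 2
  regroup = ℕ-Solver.solve-∀

triangle-2mod4 : ∀ q → triangle (2 ℕ.+ q * 4) ≡ q * (3 ℕ.+ q * 4) * 2 ℕ.+ 1
triangle-2mod4 q = ℕ.*-cancelʳ-≡ _ _ 2 (trans (triangle-gauss (1 ℕ.+ q * 4)) (regroup q))
  where
  regroup : ∀ q → (2 ℕ.+ q * 4) * (1 ℕ.+ q * 4) ≡ (q * (3 ℕ.+ q * 4) * 2 ℕ.+ 1) * 2
  regroup = ℕ-Solver.solve-∀

¬2∣odd : ∀ x → ¬ (2 ℕ.∣ x * 2 ℕ.+ 1)
¬2∣odd x 2∣odd = contradiction (ℕ.∣1⇒≡1 (ℕ.∣m+n∣m⇒∣n 2∣odd (ℕ.n∣m*n x))) λ ()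

hasPMZeroSum⇒full : ∀ {n} {S : Subset n} → HasPMZeroSum n S → ∀ x → x ∈ S
hasPMZeroSum⇒full {S = S} (g , g-inj , g∈S , _) x with injective⇒surjective g-inj x
... | y , gy≡x = subst (_∈ S) gy≡x (g∈S y)

pmProperty⇒hasPMZeroSum-⊤ : ∀ {n ℓ} → ℓ ≤ n → PMProperty n ℓ → HasPMZeroSum n ⊤
pmProperty⇒hasPMZeroSum-⊤ {n} ℓ≤n P = P ⊤ (subst (_ ≤_) (sym (Subset.∣⊤∣≡n n)) ℓ≤n)

¬pmProperty-< : ∀ {n ℓ} → ℓ < n → ¬ PMProperty n ℓ
¬pmProperty-< {suc n} (s≤s ℓ≤n) P
  with hasPMZeroSum⇒full (P (outside ∷ ⊤) (subst (_ ≤_) (sym (Subset.∣⊤∣≡n n)) ℓ≤n)) Fin.zero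
... | ()

isPMHarborth-n : ∀ {n} → HasPMZeroSum n ⊤ → IsPMHarborth n n
isPMHarborth-n {n} z = property , λ _ → ¬pmProperty-<
  where
  property : PMProperty n n
  property S n≤∣S∣ = subst (HasPMZeroSum n) (sym S≡⊤) z
    where S≡⊤ = Subset.∣p∣≡n⇒p≡⊤ (ℕ.≤-antisym (Subset.∣p∣≤n S) n≤∣S∣)

isPMHarborth-suc : ∀ {n} → ¬ HasPMZeroSum n ⊤ → IsPMHarborth n (suc n)
isPMHarborth-suc {n} ¬z = vacuous , λ _ ℓ<1+n P → ¬z (pmProperty⇒hasPMZeroSum-⊤ (s≤s⁻¹ ℓ<1+n) P)
  where
  vacuous : PMProperty n (suc n)
  vacuous S n<∣S∣ = contradiction (ℕ.≤-trans n<∣S∣ (Subset.∣p∣≤n S)) ℕ.1+n≰n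

hasPMZeroSum-⊤ : ∀ n (ε : Fin n → Sign) →
                 + n ∣ sumFin (λ i → applySign (ε i) (+ toℕ i)) → HasPMZeroSum n ⊤
hasPMZeroSum-⊤ n ε n∣sum = (λ i → i) , (λ eq → eq) , (λ _ → Subset.∈⊤) , ε , n∣sum

hasPMZeroSum-odd : ∀ j → HasPMZeroSum (suc (j * 2)) ⊤
hasPMZeroSum-odd j = hasPMZeroSum-⊤ _ (λ _ → Sign.+)
  (subst (+ n ∣_) (sym (trans (sumFin-toℕ n +_) (sumTo-+≡triangle n))) (ℕ.divides j (triangle-odd j)))
  where n = suc (j * 2)

blockPattern : ℕ → Sign
blockPattern 1 = Sign.-
blockPattern 2 = Sign.-
blockPattern _ = Sign.+

blockSign : ℕ → Sign
blockSign i = blockPattern (i % 4)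

signedBlock : ℕ → ℤ
signedBlock i = applySign (blockSign i) (+ i)

signedBlock-+ : ∀ j q → signedBlock (j ℕ.+ q * 4) ≡ applySign (blockPattern (j % 4)) (+ j ℤ.+ + (q * 4))
signedBlock-+ j q = cong (λ j% → applySign (blockPattern j%) (+ (j ℕ.+ q * 4))) ([m+kn]%n≡m%n j q 4)

sumTo-signedBlock : ∀ q → sumTo signedBlock (q * 4) ≡ + 0
sumTo-signedBlock zero    = refl
sumTo-signedBlock (suc q) = begin
  sumTo signedBlock (q * 4) ℤ.+ signedBlock (0 ℕ.+ q * 4) ℤ.+ signedBlock (1 ℕ.+ q * 4)
    ℤ.+ signedBlock (2 ℕ.+ q * 4) ℤ.+ signedBlock (3 ℕ.+ q * 4)
      ≡⟨ cong₂ ℤ._+_ (cong₂ ℤ._+_ (cong₂ ℤ._+_ (cong₂ ℤ._+_ (sumTo-signedBlock q)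
           (signedBlock-+ 0 q)) (signedBlock-+ 1 q)) (signedBlock-+ 2 q)) (signedBlock-+ 3 q) ⟩
  + 0 ℤ.+ (+ 0 ℤ.+ a) ℤ.- (+ 1 ℤ.+ a) ℤ.- (+ 2 ℤ.+ a) ℤ.+ (+ 3 ℤ.+ a)
      ≡⟨ block-cancels a ⟩
  + 0 ∎
  where
  open ≡-Reasoning
  a = + (q * 4)
  block-cancels : ∀ a → + 0 ℤ.+ (+ 0 ℤ.+ a) ℤ.- (+ 1 ℤ.+ a) ℤ.- (+ 2 ℤ.+ a) ℤ.+ (+ 3 ℤ.+ a) ≡ + 0
  block-cancels = solve-∀

hasPMZeroSum-4∣ : ∀ q → HasPMZeroSum (q * 4) ⊤
hasPMZeroSum-4∣ q = hasPMZeroSum-⊤ _ (λ i → blockSign (toℕ i))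
  (subst (+ (q * 4) ∣_) (sym (trans (sumFin-toℕ (q * 4) signedBlock) (sumTo-signedBlock q)))
         (ℕ._∣0 (q * 4)))

pmZeroSum⇒2∣triangle : ∀ {n} {S : Subset n} → 2 ℕ.∣ n → HasPMZeroSum n S → 2 ℕ.∣ triangle n
pmZeroSum⇒2∣triangle {n} 2∣n (g , g-inj , _ , ε , n∣signedSum) = ℤ.∣⇒∣ᵤ (subst (+ 2 ℤ.∣_) sum≡ 2∣sum)
  where
  gs : Fin n → ℤ
  gs i = + toℕ (g i)
  signedSum : ℤ
  signedSum = sumFin (λ i → applySign (ε i) (gs i))
  a-[a-b]≡b : ∀ a b → a ℤ.- (a ℤ.- b) ≡ b
  a-[a-b]≡b = solve-∀
  2∣sum : + 2 ℤ.∣ sumFin gs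
  2∣sum = subst (+ 2 ℤ.∣_) (a-[a-b]≡b signedSum (sumFin gs))
    (ℤ.∣m∣n⇒∣m-n (ℤ.∣-trans (ℤ.∣ᵤ⇒∣ {+ 2} {+ n} 2∣n) (ℤ.∣ᵤ⇒∣ {+ n} {signedSum} n∣signedSum))
                 (signedSum-parity ε gs))
  sum≡ : sumFin gs ≡ + triangle n
  sum≡ = trans (sumFin-permute (λ i → + toℕ i) g-inj) (trans (sumFin-toℕ n +_) (sumTo-+≡triangle n))

¬hasPMZeroSum-2mod4 : ∀ q (S : Subset (2 ℕ.+ q * 4)) → ¬ HasPMZeroSum (2 ℕ.+ q * 4) S
¬hasPMZeroSum-2mod4 q S z =
  ¬2∣odd (q * (3 ℕ.+ q * 4)) (subst (2 ℕ.∣_) (triangle-2mod4 q) (pmZeroSum⇒2∣triangle 2∣n z))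
  where
  2+q*4≡[1+q*2]*2 : ∀ q → 2 ℕ.+ q * 4 ≡ (1 ℕ.+ q * 2) * 2
  2+q*4≡[1+q*2]*2 = ℕ-Solver.solve-∀
  2∣n : 2 ℕ.∣ 2 ℕ.+ q * 4
  2∣n = ℕ.divides (1 ℕ.+ q * 2) (2+q*4≡[1+q*2]*2 q)

data Residue4 : ℕ → Set where
  0+4* : ∀ q → Residue4 (q * 4)
  1+4* : ∀ q → Residue4 (1 ℕ.+ q * 4)
  2+4* : ∀ q → Residue4 (2 ℕ.+ q * 4)
  3+4* : ∀ q → Residue4 (3 ℕ.+ q * 4)

residue4 : ∀ n → Residue4 n
residue4 0 = 0+4* 0
residue4 1 = 1+4* 0
residue4 2 = 2+4* 0
residue4 3 = 3+4* 0
residue4 (suc (suc (suc (suc n)))) with residue4 n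
... | 0+4* q = 0+4* (suc q)
... | 1+4* q = 1+4* (suc q)
... | 2+4* q = 2+4* (suc q)
... | 3+4* q = 3+4* (suc q)

residue≢2 : ∀ j q → j % 4 ≢ 2 → (j ℕ.+ q * 4) % 4 ≢ 2
residue≢2 j q j≢2 ≡2 = j≢2 (trans (sym ([m+kn]%n≡m%n j q 4)) ≡2)

pmHarborth-≢2 : ∀ {n} → n % 4 ≢ 2 → HasPMZeroSum n ⊤ →
  (n % 4 ≡ 2 → IsPMHarborth n (suc n)) × (n % 4 ≢ 2 → IsPMHarborth n n)
pmHarborth-≢2 ≢2 z = (λ ≡2 → contradiction ≡2 ≢2) , (λ _ → isPMHarborth-n z)

-- The argument also covers n = 0.
theorem1p2 : ∀ (n : ℕ) → 1 ≤ n →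
    ((n % 4 ≡ 2 → IsPMHarborth n (suc n)) × (n % 4 ≢ 2 → IsPMHarborth n n))
theorem1p2 n _ with residue4 n
... | 0+4* q = pmHarborth-≢2 (residue≢2 0 q λ ()) (hasPMZeroSum-4∣ q)
... | 1+4* q = pmHarborth-≢2 (residue≢2 1 q λ ())
  (subst (λ m → HasPMZeroSum (1 ℕ.+ m) ⊤) (ℕ.*-assoc q 2 2) (hasPMZeroSum-odd (q * 2)))
... | 3+4* q = pmHarborth-≢2 (residue≢2 3 q λ ())
  (subst (λ m → HasPMZeroSum (3 ℕ.+ m) ⊤) (ℕ.*-assoc q 2 2) (hasPMZeroSum-odd (suc (q * 2))))
... | 2+4* q = (λ _ → isPMHarborth-suc (¬hasPMZeroSum-2mod4 q ⊤))
             , (λ ≢2 → contradiction ([m+kn]%n≡m%n 2 q 4) ≢2)
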